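{- Let $\mathbb{T}=(T,\eta,(-)^*)$ be a monad and $\Sigma$ an endofunctor on a category $\mathbf{C}$ with finite coproducts, and consider the parametrized monad $A\# X=T(A+\Sigma X)$ with unit $u^X_A=\eta_{A+\Sigma X}\circ\mathsf{inl}$ and multiplication $m^X_A=[\mathrm{id},\eta_{A+\Sigma X}\circ\mathsf{inr}]^*:T(T(A+\Sigma X)+\Sigma X)\to T(A+\Sigma X)$. Then $\#$-algebras are precisely $\mathbb{T}$-$\Sigma$-bialgebras: for every object $A$, the assignment $\alpha\mapsto(\alpha\circ T\mathsf{inl},\ \alpha\circ\eta_{A+\Sigma A}\circ\mathsf{inr})$ is a bijection between $\#$-algebra structures $\alpha:T(A+\Sigma A)\to A$ on $A$ and pairs $(a,f)$ where $a:TA\to A$ is an Eilenberg–Moore $\mathbb{T}$-algebra and $f:\Sigma A\to A$ is an arbitrary morphism (a $\Sigma$-algebra).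
   Context: Monads are Kleisli triples $(T,\eta,(-)^*)$ with $Tf=(\eta\circ f)^*$, $\mu=\mathrm{id}^*$. A parametrized monad on $\mathbf{C}$ is a bifunctor $\#:\mathbf{C}\times\mathbf{C}\to\mathbf{C}$ such that each $(-)\#X$ is a monad (unit $u^X_A:A\to A\#X$, multiplication $m^X_A:(A\#X)\#X\to A\#X$) and for each $f:X\to Y$ the family $(\mathrm{id}_Z\# f)_Z$ is a monad morphism. A $\#$-algebra is a pair $(A,a)$ with $a:A\#A\to A$ satisfying $a\circ u^A_A=\mathrm{id}_A$ and $a\circ(a\#\mathrm{id}_A)=a\circ m^A_A$. An Eilenberg–Moore $\mathbb{T}$-algebra is $a:TA\to A$ with $a\circ\eta_A=\mathrm{id}$ and $a\circ Ta=a\circ\mu_A$. -}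

module Defs where

open import Level using (Level; _⊔_; suc)
open import Relation.Binary using (Rel; IsEquivalence)
open import Data.Product using (_×_; _,_; Σ-syntax)

record Category (o ℓ e : Level) : Set (suc (o ⊔ ℓ ⊔ e)) where
  infixr 9 _∘_
  infix  4 _≈_
  field
    Obj   : Set o
    Hom   : Obj → Obj → Set ℓ
    _≈_   : ∀ {A B} → Rel (Hom A B) e
    id    : ∀ {A} → Hom A A
    _∘_   : ∀ {A B C} → Hom B C → Hom A B → Hom A C
    equiv     : ∀ {A B} → IsEquivalence (_≈_ {A} {B})
    ∘-resp-≈  : ∀ {A B C} {f h : Hom B C} {g i : Hom A B} → f ≈ h → g ≈ i → f ∘ g ≈ h ∘ i
    identityˡ : ∀ {A B} {f : Hom A B} → id ∘ f ≈ f
    identityʳ : ∀ {A B} {f : Hom A B} → f ∘ id ≈ f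
    assoc     : ∀ {A B C D} {f : Hom A B} {g : Hom B C} {h : Hom C D} →
                (h ∘ g) ∘ f ≈ h ∘ (g ∘ f)

module _ {o ℓ e} (C : Category o ℓ e) where
  open Category C

  record Coproducts : Set (o ⊔ ℓ ⊔ e) where
    infixr 6 _+_
    field
      _+_  : Obj → Obj → Obj
      inl  : ∀ {A B} → Hom A (A + B)
      inr  : ∀ {A B} → Hom B (A + B)
      [_,_] : ∀ {A B X} → Hom A X → Hom B X → Hom (A + B) X
      inl-β : ∀ {A B X} {f : Hom A X} {g : Hom B X} → [ f , g ] ∘ inl ≈ f
      inr-β : ∀ {A B X} {f : Hom A X} {g : Hom B X} → [ f , g ] ∘ inr ≈ g
      unique : ∀ {A B X} {f : Hom A X} {g : Hom B X} {h : Hom (A + B) X} →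
               h ∘ inl ≈ f → h ∘ inr ≈ g → h ≈ [ f , g ]

  record Initial : Set (o ⊔ ℓ ⊔ e) where
    field
      ⊥      : Obj
      ¡      : ∀ {X} → Hom ⊥ X
      ¡-unique : ∀ {X} (h : Hom ⊥ X) → ¡ ≈ h

  record FiniteCoproducts : Set (o ⊔ ℓ ⊔ e) where
    field
      initial    : Initial
      coproducts : Coproducts

  record Endofunctor : Set (o ⊔ ℓ ⊔ e) where
    field
      F₀ : Obj → Obj
      F₁ : ∀ {A B} → Hom A B → Hom (F₀ A) (F₀ B)
      identity     : ∀ {A} → F₁ (id {A}) ≈ id
      homomorphism : ∀ {A B C} {f : Hom A B} {g : Hom B C} → F₁ (g ∘ f) ≈ F₁ g ∘ F₁ f
      F-resp-≈     : ∀ {A B} {f g : Hom A B} → f ≈ g → F₁ f ≈ F₁ g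

  record Monad : Set (o ⊔ ℓ ⊔ e) where
    field
      T   : Obj → Obj
      η   : ∀ {A} → Hom A (T A)
      _*  : ∀ {A B} → Hom A (T B) → Hom (T A) (T B)
      *-resp-≈ : ∀ {A B} {f g : Hom A (T B)} → f ≈ g → f * ≈ g *
      η*    : ∀ {A} → (η {A}) * ≈ id
      *-η   : ∀ {A B} {f : Hom A (T B)} → f * ∘ η ≈ f
      *-∘   : ∀ {A B D} {f : Hom A (T B)} {g : Hom B (T D)} → g * ∘ f * ≈ (g * ∘ f) *
    T₁ : ∀ {A B} → Hom A B → Hom (T A) (T B)
    T₁ f = (η ∘ f) *
    μ : ∀ {A} → Hom (T (T A)) (T A)
    μ = id *

  IsEMAlgebra : (M : Monad) → ∀ {A} → Hom (Monad.T M A) A → Set e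
  IsEMAlgebra M {A} a = (a ∘ η ≈ id) × (a ∘ T₁ a ≈ a ∘ μ)
    where open Monad M

  module Hash (cp : FiniteCoproducts) (M : Monad) (S : Endofunctor) where
    open Coproducts (FiniteCoproducts.coproducts cp)
    open Monad M
    open Endofunctor S renaming (F₀ to Σ₀; F₁ to Σ₁)

    _⊕_ : ∀ {A B A' B'} → Hom A A' → Hom B B' → Hom (A + B) (A' + B')
    f ⊕ g = [ inl ∘ f , inr ∘ g ]

    _#_ : Obj → Obj → Obj
    A # X = T (A + Σ₀ X)

    _#₁_ : ∀ {A A' X X'} → Hom A A' → Hom X X' → Hom (A # X) (A' # X')
    f #₁ g = T₁ (f ⊕ Σ₁ g)

    u : ∀ {A X} → Hom A (A # X)
    u = η ∘ inl

    m : ∀ {A X} → Hom ((A # X) # X) (A # X)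
    m = [ id , η ∘ inr ] *

    IsHashAlgebra : ∀ {A} → Hom (A # A) A → Set e
    IsHashAlgebra {A} α = (α ∘ u ≈ id) × (α ∘ (α #₁ id {A}) ≈ α ∘ m)

    toBialg : ∀ {A} → Hom (A # A) A → Hom (T A) A × Hom (Σ₀ A) A
    toBialg α = (α ∘ T₁ inl , α ∘ (η ∘ inr))

-- A #-algebra α : T (A + Σ A) → A is determined by its restrictions a = α ∘ T inl and
-- f = α ∘ η ∘ inr: the unit law says α ∘ η = [ id , f ], and the multiplication law,
-- precomposed with T (inl ∘ h), turns into α ∘ T (inl ∘ α ∘ h) = α ∘ h*. Taking h = η gives
-- α = a ∘ T [ id , f ], taking h = T inl gives the multiplication law of a. Conversely, for an
-- Eilenberg–Moore algebra a, the composite a ∘ T [ id , f ] is a #-algebra because a absorbs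
-- Kleisli extension: a ∘ k* = a ∘ T (a ∘ k).
module Submission where

open import Defs
open import Level using (Level)
open import Data.Product using (_×_; _,_; Σ-syntax; proj₁; proj₂)
open import Relation.Binary using (Setoid; IsEquivalence)
import Relation.Binary.Reasoning.Setoid as SetoidReasoning

module CategoryProperties {o ℓ e : Level} (C : Category o ℓ e) where
  open Category C

  hom-setoid : Obj → Obj → Setoid ℓ e
  hom-setoid X Y = record { Carrier = Hom X Y ; _≈_ = _≈_ ; isEquivalence = equiv }

  module HomReasoning {X Y : Obj} = SetoidReasoning (hom-setoid X Y)

  open module ≈-Equivalence {X Y : Obj} = IsEquivalence (equiv {X} {Y}) public
    using () renaming (refl to ≈-refl; sym to ≈-sym; trans to ≈-trans)

  infixr 4 _⟩∘⟨_
  _⟩∘⟨_ : ∀ {X Y Z} {f h : Hom Y Z} {g i : Hom X Y} → f ≈ h → g ≈ i → f ∘ g ≈ h ∘ i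
  _⟩∘⟨_ = ∘-resp-≈

  pullˡ : ∀ {W X Y Z} {f : Hom Y Z} {g : Hom X Y} {k : Hom X Z} {h : Hom W X} →
          f ∘ g ≈ k → f ∘ (g ∘ h) ≈ k ∘ h
  pullˡ p = ≈-trans (≈-sym assoc) (p ⟩∘⟨ ≈-refl)

module CoproductProperties {o ℓ e : Level} {C : Category o ℓ e} (cp : Coproducts C) where
  open Category C
  open CategoryProperties C
  open Coproducts cp

  []-cong : ∀ {A B X} {f f' : Hom A X} {g g' : Hom B X} → f ≈ f' → g ≈ g' → [ f , g ] ≈ [ f' , g' ]
  []-cong p q = unique (≈-trans inl-β p) (≈-trans inr-β q)

  ∘-[] : ∀ {A B X Y} {f : Hom A X} {g : Hom B X} {h : Hom X Y} → h ∘ [ f , g ] ≈ [ h ∘ f , h ∘ g ]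
  ∘-[] = unique (≈-trans assoc (≈-refl ⟩∘⟨ inl-β)) (≈-trans assoc (≈-refl ⟩∘⟨ inr-β))

module MonadProperties {o ℓ e : Level} {C : Category o ℓ e} (M : Monad C) where
  open Category C
  open CategoryProperties C
  open Monad M

  *-∘-η : ∀ {X A B} {g : Hom A (T B)} {x : Hom X A} → g * ∘ (η ∘ x) ≈ g ∘ x
  *-∘-η = pullˡ *-η

  *-∘-T₁ : ∀ {X A B} {g : Hom A (T B)} {x : Hom X A} → g * ∘ T₁ x ≈ (g ∘ x) *
  *-∘-T₁ = ≈-trans *-∘ (*-resp-≈ *-∘-η)

  *-∘-μ : ∀ {A B} {g : Hom A (T B)} → g * ∘ μ ≈ (g *) *
  *-∘-μ = ≈-trans *-∘ (*-resp-≈ identityʳ)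

  T₁-resp-≈ : ∀ {X Y} {f g : Hom X Y} → f ≈ g → T₁ f ≈ T₁ g
  T₁-resp-≈ p = *-resp-≈ (≈-refl ⟩∘⟨ p)

  T₁-identity : ∀ {X} → T₁ (id {X}) ≈ id
  T₁-identity = ≈-trans (*-resp-≈ identityʳ) η*

  T₁-∘ : ∀ {X Y Z} {f : Hom Y Z} {g : Hom X Y} → T₁ f ∘ T₁ g ≈ T₁ (f ∘ g)
  T₁-∘ = ≈-trans *-∘-T₁ (*-resp-≈ assoc)

  module EMAlgebra {A : Obj} {a : Hom (T A) A} (isEM : IsEMAlgebra C M a) where
    open HomReasoning

    ∘-T₁-∘-η : ∀ {X} {g : Hom X A} → (a ∘ T₁ g) ∘ η ≈ g
    ∘-T₁-∘-η {g = g} = begin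
      (a ∘ T₁ g) ∘ η ≈⟨ assoc ⟩
      a ∘ (T₁ g ∘ η) ≈⟨ ≈-refl ⟩∘⟨ *-η ⟩
      a ∘ (η ∘ g)    ≈⟨ pullˡ (proj₁ isEM) ⟩
      id ∘ g         ≈⟨ identityˡ ⟩
      g              ∎

    ∘-* : ∀ {X} {k : Hom X (T A)} → a ∘ k * ≈ a ∘ T₁ (a ∘ k)
    ∘-* {k = k} = ≈-sym (begin
      a ∘ T₁ (a ∘ k)   ≈⟨ ≈-refl ⟩∘⟨ ≈-sym T₁-∘ ⟩
      a ∘ (T₁ a ∘ T₁ k) ≈⟨ pullˡ (proj₂ isEM) ⟩
      (a ∘ μ) ∘ T₁ k    ≈⟨ assoc ⟩
      a ∘ (μ ∘ T₁ k)    ≈⟨ ≈-refl ⟩∘⟨ *-∘-T₁ ⟩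
      a ∘ (id ∘ k) *    ≈⟨ ≈-refl ⟩∘⟨ *-resp-≈ identityˡ ⟩
      a ∘ k *           ∎)

module HashAlgebras {o ℓ e : Level} (C : Category o ℓ e) (cp : FiniteCoproducts C)
                    (M : Monad C) (S : Endofunctor C) where
  open Category C
  open Monad M
  open Endofunctor S renaming (F₀ to Σ₀; F₁ to Σ₁)
  open Hash C cp M S
  open Coproducts (FiniteCoproducts.coproducts cp)
  open CategoryProperties C
  open CoproductProperties (FiniteCoproducts.coproducts cp)
  open MonadProperties M
  open HomReasoning

  fromBialg : ∀ {A} → Hom (T A) A → Hom (Σ₀ A) A → Hom (A # A) A
  fromBialg a f = a ∘ T₁ [ id , f ]

  m-∘-T₁-inl : ∀ {X A B} {h : Hom X (A # B)} → m ∘ T₁ (inl ∘ h) ≈ h *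
  m-∘-T₁-inl = ≈-trans *-∘-T₁ (*-resp-≈ (≈-trans (pullˡ inl-β) identityˡ))

  module HashAlgebra {A : Obj} {α : Hom (A # A) A} (isHash : IsHashAlgebra α) where

    ∘-η : α ∘ η ≈ [ id , α ∘ (η ∘ inr) ]
    ∘-η = unique (≈-trans assoc (proj₁ isHash)) assoc

    ∘-* : ∀ {X} {h : Hom X (A # A)} → α ∘ h * ≈ α ∘ T₁ (inl ∘ (α ∘ h))
    ∘-* {h = h} = ≈-sym (begin
      α ∘ T₁ (inl ∘ (α ∘ h))                  ≈⟨ ≈-refl ⟩∘⟨ T₁-resp-≈ (≈-sym (≈-trans (pullˡ inl-β) assoc)) ⟩
      α ∘ T₁ ((α ⊕ Σ₁ id) ∘ (inl ∘ h))        ≈⟨ ≈-refl ⟩∘⟨ ≈-sym T₁-∘ ⟩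
      α ∘ (T₁ (α ⊕ Σ₁ id) ∘ T₁ (inl ∘ h))     ≈⟨ pullˡ (proj₂ isHash) ⟩
      (α ∘ m) ∘ T₁ (inl ∘ h)                  ≈⟨ assoc ⟩
      α ∘ (m ∘ T₁ (inl ∘ h))                  ≈⟨ ≈-refl ⟩∘⟨ m-∘-T₁-inl ⟩
      α ∘ h *                                 ∎)

    toBialg-EM : IsEMAlgebra C M (proj₁ (toBialg α))
    toBialg-EM = unit , mult
      where
      unit : (α ∘ T₁ inl) ∘ η ≈ id
      unit = ≈-trans assoc (≈-trans (≈-refl ⟩∘⟨ *-η) (proj₁ isHash))

      mult : (α ∘ T₁ inl) ∘ T₁ (α ∘ T₁ inl) ≈ (α ∘ T₁ inl) ∘ μ
      mult = begin
        (α ∘ T₁ inl) ∘ T₁ (α ∘ T₁ inl) ≈⟨ assoc ⟩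
        α ∘ (T₁ inl ∘ T₁ (α ∘ T₁ inl)) ≈⟨ ≈-refl ⟩∘⟨ T₁-∘ ⟩
        α ∘ T₁ (inl ∘ (α ∘ T₁ inl))    ≈⟨ ≈-sym ∘-* ⟩
        α ∘ (T₁ inl) *                 ≈⟨ ≈-refl ⟩∘⟨ ≈-sym *-∘-μ ⟩
        α ∘ (T₁ inl ∘ μ)               ≈⟨ ≈-sym assoc ⟩
        (α ∘ T₁ inl) ∘ μ               ∎

    fromBialg-toBialg : fromBialg (proj₁ (toBialg α)) (proj₂ (toBialg α)) ≈ α
    fromBialg-toBialg = begin
      (α ∘ T₁ inl) ∘ T₁ [ id , α ∘ (η ∘ inr) ] ≈⟨ assoc ⟩
      α ∘ (T₁ inl ∘ T₁ [ id , α ∘ (η ∘ inr) ]) ≈⟨ ≈-refl ⟩∘⟨ T₁-∘ ⟩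
      α ∘ T₁ (inl ∘ [ id , α ∘ (η ∘ inr) ])    ≈⟨ ≈-refl ⟩∘⟨ T₁-resp-≈ (≈-refl ⟩∘⟨ ≈-sym ∘-η) ⟩
      α ∘ T₁ (inl ∘ (α ∘ η))                   ≈⟨ ≈-sym ∘-* ⟩
      α ∘ η *                                  ≈⟨ ≈-refl ⟩∘⟨ η* ⟩
      α ∘ id                                   ≈⟨ identityʳ ⟩
      α                                        ∎

  toBialg-injective : ∀ {A} (α β : Hom (A # A) A) → IsHashAlgebra α → IsHashAlgebra β →
                      proj₁ (toBialg α) ≈ proj₁ (toBialg β) → proj₂ (toBialg α) ≈ proj₂ (toBialg β) →
                      α ≈ β
  toBialg-injective α β isHashα isHashβ p q = begin
    α                                         ≈⟨ ≈-sym (HashAlgebra.fromBialg-toBialg isHashα) ⟩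
    fromBialg (α ∘ T₁ inl) (α ∘ (η ∘ inr))    ≈⟨ p ⟩∘⟨ T₁-resp-≈ ([]-cong ≈-refl q) ⟩
    fromBialg (β ∘ T₁ inl) (β ∘ (η ∘ inr))    ≈⟨ HashAlgebra.fromBialg-toBialg isHashβ ⟩
    β                                         ∎

  module Bialgebra {A : Obj} {a : Hom (T A) A} (f : Hom (Σ₀ A) A) (isEM : IsEMAlgebra C M a) where
    open MonadProperties.EMAlgebra M isEM

    α : Hom (A # A) A
    α = fromBialg a f

    ∘-η-∘ : ∀ {X} {x : Hom X (A + Σ₀ A)} → α ∘ (η ∘ x) ≈ [ id , f ] ∘ x
    ∘-η-∘ = ≈-trans (≈-sym assoc) (∘-T₁-∘-η ⟩∘⟨ ≈-refl)

    toBialg₁ : proj₁ (toBialg α) ≈ a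
    toBialg₁ = begin
      (a ∘ T₁ [ id , f ]) ∘ T₁ inl ≈⟨ assoc ⟩
      a ∘ (T₁ [ id , f ] ∘ T₁ inl) ≈⟨ ≈-refl ⟩∘⟨ ≈-trans T₁-∘ (T₁-resp-≈ inl-β) ⟩
      a ∘ T₁ id                    ≈⟨ ≈-refl ⟩∘⟨ T₁-identity ⟩
      a ∘ id                       ≈⟨ identityʳ ⟩
      a                            ∎

    toBialg₂ : proj₂ (toBialg α) ≈ f
    toBialg₂ = ≈-trans ∘-η-∘ inr-β

    isHash : IsHashAlgebra α
    isHash = ≈-trans ∘-η-∘ inl-β , mult
      where
      copair-∘-⊕ : [ id , f ] ∘ (α ⊕ Σ₁ id) ≈ [ α , f ]
      copair-∘-⊕ = ≈-trans ∘-[] ([]-cong (≈-trans (pullˡ inl-β) identityˡ)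
                                         (≈-trans (pullˡ inr-β) (≈-trans (≈-refl ⟩∘⟨ identity) identityʳ)))

      k : Hom ((A # A) + Σ₀ A) (T A)
      k = T₁ [ id , f ] ∘ [ id , η ∘ inr ]

      a-∘-k : a ∘ k ≈ [ α , f ]
      a-∘-k = ≈-trans (≈-sym assoc) (≈-trans ∘-[] ([]-cong identityʳ toBialg₂))

      mult : α ∘ (α #₁ id) ≈ α ∘ m
      mult = begin
        α ∘ T₁ (α ⊕ Σ₁ id)                           ≈⟨ assoc ⟩
        a ∘ (T₁ [ id , f ] ∘ T₁ (α ⊕ Σ₁ id))         ≈⟨ ≈-refl ⟩∘⟨ ≈-trans T₁-∘ (T₁-resp-≈ copair-∘-⊕) ⟩
        a ∘ T₁ [ α , f ]                             ≈⟨ ≈-refl ⟩∘⟨ T₁-resp-≈ (≈-sym a-∘-k) ⟩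
        a ∘ T₁ (a ∘ k)                               ≈⟨ ≈-sym ∘-* ⟩
        a ∘ k *                                      ≈⟨ ≈-refl ⟩∘⟨ ≈-sym *-∘ ⟩
        a ∘ (T₁ [ id , f ] ∘ m)                      ≈⟨ ≈-sym assoc ⟩
        α ∘ m                                        ∎

  toBialg-surjective : ∀ {A} (a : Hom (T A) A) (f : Hom (Σ₀ A) A) → IsEMAlgebra C M a →
                       Σ[ α ∈ Hom (A # A) A ] (IsHashAlgebra α × (proj₁ (toBialg α) ≈ a)
                         × (proj₂ (toBialg α) ≈ f))
  toBialg-surjective a f isEM = α , isHash , toBialg₁ , toBialg₂
    where open Bialgebra f isEM

proposition4p6 : ∀ {o ℓ e : Level} (C : Category o ℓ e) (cp : FiniteCoproducts C)
    (M : Monad C) (S : Endofunctor C) (A : Category.Obj C) →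
    let open Category C
        open Monad M
        open Endofunctor S renaming (F₀ to Σ₀)
        open Hash C cp M S
    in ((α : Hom (A # A) A) → IsHashAlgebra α →
          IsEMAlgebra C M (proj₁ (toBialg α)))
       × ((α β : Hom (A # A) A) → IsHashAlgebra α → IsHashAlgebra β →
          proj₁ (toBialg α) ≈ proj₁ (toBialg β) → proj₂ (toBialg α) ≈ proj₂ (toBialg β) →
          α ≈ β)
       × ((a : Hom (T A) A) (f : Hom (Σ₀ A) A) → IsEMAlgebra C M a →
          Σ[ α ∈ Hom (A # A) A ] (IsHashAlgebra α × (proj₁ (toBialg α) ≈ a)
            × (proj₂ (toBialg α) ≈ f)))
proposition4p6 C cp M S A =
  (λ _ → HashAlgebra.toBialg-EM) , toBialg-injective , toBialg-surjective
  where open HashAlgebras C cp M S
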